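{- Let $m,n>1$ be integers and $p=\gcd(m,n)>1$. Then: (1) $\tau(T_{m\times n})\geq \tau(T_{p\times p})$; (2) if for every line $\ell$ on $T_{p\times p}$ the preimage $\rho^{ -1}(\ell)$ is a line on $T_{m\times n}$, then $\tau(T_{m\times n})=\tau(T_{p\times p})$.
   Context: For integers $m,n>1$, the discrete torus is $T_{m\times n}=\{0,\dots,m-1\}\times\{0,\dots,n-1\}$, with projection $\pi_{m,n}:\mathbb Z\times\mathbb Z\to T_{m\times n}$, $\pi_{m,n}(a,b)=(a \bmod m,\ b\bmod n)$ (least non-negative remainders). A line in $\mathbb Z\times\mathbb Z$ is a set $\{(a+uk,b+vk):k\in\mathbb Z\}$ with $a,b,u,v\in\mathbb Z$ and $\gcd(u,v)=1$. A line on $T_{m\times n}$ is the image under $\pi_{m,n}$ of a line in $\mathbb Z\times\mathbb Z$. Three points are collinear if some line contains all three; a set satisfies the no-three-in-line condition if no three of its distinct points are collinear, and $\tau(T_{m\times n})$ is the maximum size of such a subset of $T_{m\times n}$. The map $\rho:T_{m\times n}\to T_{p\times p}$ is $\rho(u,v)=(u\bmod p, v\bmod p)$. -}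

module Defs where

open import Level using (Level; 0ℓ) renaming (suc to lsuc)
open import Data.Nat using (ℕ; NonZero; _≤_)
open import Data.Nat.DivMod using (_mod_)
open import Data.Fin using (Fin; toℕ)
open import Data.Integer using (ℤ; _+_; _*_; 1ℤ)
open import Data.Integer.DivMod using (_%ℕ_)
open import Data.Integer.GCD using (gcd)
open import Data.Product using (_×_; _,_; ∃; ∃-syntax; Σ-syntax)
open import Data.List using (List; length)
open import Data.List.Membership.Propositional using (_∈_)
open import Data.List.Relation.Unary.Unique.Propositional using (Unique)
open import Relation.Binary.PropositionalEquality using (_≡_; _≢_)
open import Relation.Nullary using (¬_)
open import Function.Bundles using (_⇔_)

Torus : ℕ → ℕ → Set
Torus m n = Fin m × Fin n

modF : ℤ → (m : ℕ) → .{{NonZero m}} → Fin m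
modF a m = (a %ℕ m) mod m

π : (m n : ℕ) → .{{NonZero m}} → .{{NonZero n}} → ℤ × ℤ → Torus m n
π m n (a , b) = modF a m , modF b n

-- A line in ℤ×ℤ, parametrised by (a,b,u,v) with gcd(u,v) = 1:
-- the set {(a+uk, b+vk) : k ∈ ℤ}.
record LineData : Set where
  constructor mkLine
  field
    a b u v : ℤ
    coprime : gcd u v ≡ 1ℤ

OnZLine : LineData → ℤ × ℤ → Set
OnZLine (mkLine a b u v _) (x , y) = ∃[ k ] ((a + u * k ≡ x) × (b + v * k ≡ y))

IsLine : (m n : ℕ) → .{{NonZero m}} → .{{NonZero n}} → (Torus m n → Set) → Set
IsLine m n L = ∃[ ℓ ] (∀ t → L t ⇔ (∃[ z ] (OnZLine ℓ z × π m n z ≡ t)))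

Collinear : (m n : ℕ) → .{{NonZero m}} → .{{NonZero n}} → Torus m n → Torus m n → Torus m n → Set₁
Collinear m n x y z = ∃[ L ] (IsLine m n L × L x × L y × L z)

record NoThreeInLine (m n : ℕ) .{{_ : NonZero m}} .{{_ : NonZero n}} (S : List (Torus m n)) : Set₁ where
  field
    distinct : Unique S
    noThree  : ∀ {x y z} → x ∈ S → y ∈ S → z ∈ S →
               x ≢ y → y ≢ z → x ≢ z → ¬ Collinear m n x y z

record IsTau (m n : ℕ) .{{_ : NonZero m}} .{{_ : NonZero n}} (t : ℕ) : Set₁ where
  field
    attained : ∃[ S ] (NoThreeInLine m n S × length S ≡ t)
    maximal  : ∀ S → NoThreeInLine m n S → length S ≤ t

ρ : (m n p : ℕ) → .{{NonZero p}} → Torus m n → Torus p p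
ρ m n p (i , j) = toℕ i mod p , toℕ j mod p

-- ρ commutes with the projections π, so it sends lines on T_{m×n} into lines
-- on T_{p×p}; as ρ is the identity on the copy {0,…,p-1}² of T_{p×p} inside
-- T_{m×n}, a no-three-in-line set of T_{p×p} stays one in T_{m×n}.  Under the
-- hypothesis of (2) lines pull back along ρ.  Then ρ is injective on a
-- no-three-in-line set S of at least three points (if ρ x = ρ y for x ≠ y, pick
-- a third point z of S: the pull-back of a line through ρ x and ρ z contains
-- x, y and z), and ρ(S) is again no-three-in-line; smaller sets are dominated by
-- any two points of T_{p×p}.
module Submission where

open import Defs
open import Data.Nat using (ℕ; _<_; _≤_; NonZero)
open import Data.Nat.GCD using (gcd)
open import Data.Product using (_×_)
open import Relation.Binary.PropositionalEquality using (_≡_)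

open import Data.Nat as ℕ using (suc; z≤n; s≤s; z<s; ≢-nonZero)
import Data.Nat.Properties as ℕP
open import Data.Nat.GCD using (gcd[m,n]∣m; gcd[m,n]∣n)
open import Data.Nat.Coprimality using (coprime⇒gcd≡1; coprime-/gcd)
open import Data.Nat.DivMod using (_mod_; _%_; _/_; m<n⇒m%n≡m; m%n<n; m/n*n≡m)
open import Data.Nat.Divisibility using (_∣_; divides; ∣⇒≤)
open import Data.Integer using (ℤ; +_; +0; +[1+_]; -[1+_]; _+_; _*_; _-_; _⊖_; ∣_∣; sign; _◃_; 0ℤ; 1ℤ)
import Data.Integer.Properties as ℤP
import Data.Integer.GCD as ℤG
open import Data.Integer.DivMod using (_%ℕ_; _/ℕ_; n%ℕd<d; a≡a%ℕn+[a/ℕn]*n)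
open import Data.Integer.Tactic.RingSolver using (solve-∀)
import Data.Sign as Sign
import Data.Sign.Properties as SignP
open import Data.Fin as F using (Fin; toℕ; fromℕ<; inject≤)
import Data.Fin.Properties as FP
open import Data.Product using (_,_; ∃-syntax; Σ-syntax; proj₂)
open import Data.Product.Properties using (≡-dec)
open import Data.Sum using (inj₁; inj₂)
open import Data.Empty using (⊥; ⊥-elim)
open import Data.List using (List; []; _∷_; map; length)
open import Data.List.Properties using (length-map)
open import Data.List.Membership.Propositional using (_∈_)
open import Data.List.Membership.Propositional.Properties using (∈-map⁻; ∈-++⁺ˡ)
open import Data.List.Relation.Unary.Any using (here; there)
open import Data.List.Relation.Unary.All using (All; []; _∷_)
open import Data.List.Relation.Unary.AllPairs using ([]; _∷_)
open import Data.List.Relation.Unary.Unique.Propositional using (Unique)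
open import Relation.Binary.Definitions using (DecidableEquality)
open import Relation.Binary.PropositionalEquality using (refl; sym; trans; cong; cong₂; subst; _≢_; ≢-sym; module ≡-Reasoning)
open import Relation.Nullary using (¬_; yes; no)
open import Function using (_∘_; Equivalence)
open import Function.Construct.Identity using (⇔-id)

open ≡-Reasoning

-- Remainders of integers

n<d⇒+n≡t*d⇒n≡0 : ∀ {n d} t → n < d → + n ≡ t * + d → n ≡ 0
n<d⇒+n≡t*d⇒n≡0 {d = suc _} +0 _ n≡ = ℤP.+-injective n≡
n<d⇒+n≡t*d⇒n≡0 {d = d@(suc _)} +[1+ j ] n<d refl = ⊥-elim (ℕP.<⇒≱ n<d (ℕP.m≤n*m d (suc j)))
n<d⇒+n≡t*d⇒n≡0 {d = suc _} -[1+ _ ] _ ()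

remainder-unique-≤ : ∀ {d r r′} q q′ → r ≤ r′ → r′ < d →
                     + r + q * + d ≡ + r′ + q′ * + d → r ≡ r′
remainder-unique-≤ {d} {r} {r′} q q′ r≤r′ r′<d eq =
  ℕP.≤-antisym r≤r′ (ℕP.m∸n≡0⇒m≤n (n<d⇒+n≡t*d⇒n≡0 (q - q′) (ℕP.≤-<-trans (ℕP.m∸n≤m r′ r) r′<d) gap))
  where
  regroup₁ : ∀ x y b D → y - x ≡ (y + b * D) - x - b * D
  regroup₁ = solve-∀
  regroup₂ : ∀ x a b D → (x + a * D) - x - b * D ≡ (a - b) * D
  regroup₂ = solve-∀
  gap : + (r′ ℕ.∸ r) ≡ (q - q′) * + d
  gap = begin
    + (r′ ℕ.∸ r)                        ≡⟨ sym (ℤP.⊖-≥ r≤r′) ⟩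
    r′ ⊖ r                              ≡⟨ sym (ℤP.m-n≡m⊖n r′ r) ⟩
    + r′ - + r                          ≡⟨ regroup₁ (+ r) (+ r′) q′ (+ d) ⟩
    (+ r′ + q′ * + d) - + r - q′ * + d  ≡⟨ cong (λ w → w - + r - q′ * + d) (sym eq) ⟩
    (+ r + q * + d) - + r - q′ * + d    ≡⟨ regroup₂ (+ r) q q′ (+ d) ⟩
    (q - q′) * + d                      ∎

remainder-unique : ∀ {d r r′} q q′ → r < d → r′ < d →
                   + r + q * + d ≡ + r′ + q′ * + d → r ≡ r′
remainder-unique {r = r} {r′} q q′ r<d r′<d eq with ℕP.≤-total r r′
... | inj₁ r≤r′ = remainder-unique-≤ q q′ r≤r′ r′<d eq
... | inj₂ r′≤r = sym (remainder-unique-≤ q′ q r′≤r r<d (sym eq))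

%ℕ-unique : ∀ a d .{{_ : NonZero d}} {r} q → r < d → a ≡ + r + q * + d → a %ℕ d ≡ r
%ℕ-unique a d q r<d a≡ =
  remainder-unique (a /ℕ d) q (n%ℕd<d a d) r<d (trans (sym (a≡a%ℕn+[a/ℕn]*n a d)) a≡)

[n+k*d]%ℕd≡n%d : ∀ n k d .{{_ : NonZero d}} → (+ n + k * + d) %ℕ d ≡ n % d
[n+k*d]%ℕd≡n%d n k d = %ℕ-unique _ d (+ (n / d) + k) (m%n<n n d) (begin
  + n + k * + d                          ≡⟨ cong (_+ k * + d) (a≡a%ℕn+[a/ℕn]*n (+ n) d) ⟩
  + (n % d) + + (n / d) * + d + k * + d  ≡⟨ regroup (+ (n % d)) (+ (n / d)) k (+ d) ⟩
  + (n % d) + (+ (n / d) + k) * + d      ∎)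
  where
  regroup : ∀ x y k D → x + y * D + k * D ≡ x + (y + k) * D
  regroup = solve-∀

m∣n⇒i%ℕn%m≡i%ℕm : ∀ i {m n} .{{_ : NonZero m}} .{{_ : NonZero n}} → m ∣ n → i %ℕ n % m ≡ i %ℕ m
m∣n⇒i%ℕn%m≡i%ℕm i {m} {n} (divides c n≡c*m) = sym (begin
  i %ℕ m                                    ≡⟨ cong (λ j → j %ℕ m) (a≡a%ℕn+[a/ℕn]*n i n) ⟩
  (+ (i %ℕ n) + (i /ℕ n) * + n) %ℕ m        ≡⟨ cong (λ j → (+ (i %ℕ n) + j) %ℕ m) n-as-multiple ⟩
  (+ (i %ℕ n) + (i /ℕ n) * + c * + m) %ℕ m  ≡⟨ [n+k*d]%ℕd≡n%d (i %ℕ n) ((i /ℕ n) * + c) m ⟩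
  i %ℕ n % m                                ∎)
  where
  n-as-multiple : (i /ℕ n) * + n ≡ (i /ℕ n) * + c * + m
  n-as-multiple = trans (cong ((i /ℕ n) *_) (trans (cong +_ n≡c*m) (ℤP.pos-* c m)))
                        (sym (ℤP.*-assoc (i /ℕ n) (+ c) (+ m)))

-- Projections between tori

toℕ-mod : ∀ k d .{{_ : NonZero d}} → toℕ (k mod d) ≡ k % d
toℕ-mod k d = FP.toℕ-fromℕ< (m%n<n k d)

toℕ-modF : ∀ a d .{{_ : NonZero d}} → toℕ (modF a d) ≡ a %ℕ d
toℕ-modF a d = trans (toℕ-mod (a %ℕ d) d) (m<n⇒m%n≡m (n%ℕd<d a d))

mod-toℕ : ∀ {d} .{{_ : NonZero d}} (i : Fin d) → toℕ i mod d ≡ i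
mod-toℕ {d} i = FP.toℕ-injective (trans (toℕ-mod (toℕ i) d) (m<n⇒m%n≡m (FP.toℕ<n i)))

modF-+toℕ : ∀ {d} .{{_ : NonZero d}} (i : Fin d) → modF (+ toℕ i) d ≡ i
modF-+toℕ {d} i = FP.toℕ-injective (trans (toℕ-modF (+ toℕ i) d) (m<n⇒m%n≡m (FP.toℕ<n i)))

modF-mod-∣ : ∀ a {m p} .{{_ : NonZero m}} .{{_ : NonZero p}} → p ∣ m → toℕ (modF a m) mod p ≡ modF a p
modF-mod-∣ a {m} {p} p∣m = FP.toℕ-injective (begin
  toℕ (toℕ (modF a m) mod p)  ≡⟨ toℕ-mod (toℕ (modF a m)) p ⟩
  toℕ (modF a m) % p          ≡⟨ cong (_% p) (toℕ-modF a m) ⟩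
  a %ℕ m % p                  ≡⟨ m∣n⇒i%ℕn%m≡i%ℕm a p∣m ⟩
  a %ℕ p                      ≡⟨ sym (toℕ-modF a p) ⟩
  toℕ (modF a p)              ∎)

liftℤ : ∀ {m n} → Torus m n → ℤ × ℤ
liftℤ (i , j) = + toℕ i , + toℕ j

π-liftℤ : ∀ {m n} .{{_ : NonZero m}} .{{_ : NonZero n}} (t : Torus m n) → π m n (liftℤ t) ≡ t
π-liftℤ (i , j) = cong₂ _,_ (modF-+toℕ i) (modF-+toℕ j)

module _ {m n p : ℕ} .{{_ : NonZero m}} .{{_ : NonZero n}} .{{_ : NonZero p}} where

  ρ-π : p ∣ m → p ∣ n → ∀ z → ρ m n p (π m n z) ≡ π p p z
  ρ-π p∣m p∣n (a , b) = cong₂ _,_ (modF-mod-∣ a p∣m) (modF-mod-∣ b p∣n)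

  embed : p ≤ m → p ≤ n → Torus p p → Torus m n
  embed p≤m p≤n (i , j) = inject≤ i p≤m , inject≤ j p≤n

  ρ-embed : (p≤m : p ≤ m) (p≤n : p ≤ n) → ∀ t → ρ m n p (embed p≤m p≤n t) ≡ t
  ρ-embed p≤m p≤n (i , j) =
    cong₂ _,_ (trans (cong (_mod p) (FP.toℕ-inject≤ i p≤m)) (mod-toℕ i))
              (trans (cong (_mod p) (FP.toℕ-inject≤ j p≤n)) (mod-toℕ j))

-- Lines

torusLine : LineData → (m n : ℕ) .{{_ : NonZero m}} .{{_ : NonZero n}} → Torus m n → Set
torusLine ℓ m n t = ∃[ z ] (OnZLine ℓ z × π m n z ≡ t)

torusLine-isLine : ∀ ℓ {m n} .{{_ : NonZero m}} .{{_ : NonZero n}} → IsLine m n (torusLine ℓ m n)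
torusLine-isLine ℓ {m} {n} = ℓ , λ t → ⇔-id (torusLine ℓ m n t)

primitive-multiple : ∀ x y → ∃[ u ] ∃[ v ] ∃[ k ] (ℤG.gcd u v ≡ 1ℤ × u * k ≡ x × v * k ≡ y)
primitive-multiple x y with gcd ∣ x ∣ ∣ y ∣ ℕ.≟ 0
... | yes g≡0 = 1ℤ , 0ℤ , 0ℤ , refl ,
      sym (ℤG.gcd[i,j]≡0⇒i≡0 x y (cong +_ g≡0)) , sym (ℤG.gcd[i,j]≡0⇒j≡0 {x} (cong +_ g≡0))
... | no g≢0 = sign x ◃ (∣ x ∣ / g) , sign y ◃ (∣ y ∣ / g) , + g , coprime ,
               quotient-times-gcd x (gcd[m,n]∣m ∣ x ∣ ∣ y ∣) , quotient-times-gcd y (gcd[m,n]∣n ∣ x ∣ ∣ y ∣)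
  where
  g = gcd ∣ x ∣ ∣ y ∣
  instance
    g-nonZero : NonZero g
    g-nonZero = ≢-nonZero g≢0
  coprime : ℤG.gcd (sign x ◃ (∣ x ∣ / g)) (sign y ◃ (∣ y ∣ / g)) ≡ 1ℤ
  coprime = cong +_ (trans (cong₂ gcd (ℤP.abs-◃ (sign x) (∣ x ∣ / g)) (ℤP.abs-◃ (sign y) (∣ y ∣ / g)))
                           (coprime⇒gcd≡1 (coprime-/gcd ∣ x ∣ ∣ y ∣)))
  quotient-times-gcd : ∀ i → g ∣ ∣ i ∣ → (sign i ◃ (∣ i ∣ / g)) * + g ≡ i
  quotient-times-gcd i g∣i = begin
    (sign i ◃ (∣ i ∣ / g)) * + g             ≡⟨ cong ((sign i ◃ (∣ i ∣ / g)) *_) (sym (ℤP.+◃n≡+n g)) ⟩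
    (sign i ◃ (∣ i ∣ / g)) * (Sign.+ ◃ g)    ≡⟨ sym (ℤP.◃-distrib-* (sign i) Sign.+ (∣ i ∣ / g) g) ⟩
    (sign i Sign.* Sign.+) ◃ (∣ i ∣ / g ℕ.* g) ≡⟨ cong₂ _◃_ (SignP.*-identityʳ (sign i)) (m/n*n≡m g∣i) ⟩
    sign i ◃ ∣ i ∣                           ≡⟨ ℤP.◃-inverse i ⟩
    i                                        ∎

ℤ-line-through : ∀ A B → ∃[ ℓ ] (OnZLine ℓ A × OnZLine ℓ B)
ℤ-line-through (a₁ , a₂) (b₁ , b₂) with primitive-multiple (b₁ - a₁) (b₂ - a₂)
... | u , v , k , coprime , uk≡ , vk≡ =
  mkLine a₁ a₂ u v coprime ,
  (0ℤ , +-*-zeroʳ a₁ u , +-*-zeroʳ a₂ v) ,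
  (k , trans (cong (_+_ a₁) uk≡) (a+[b-a]≡b a₁ b₁) , trans (cong (_+_ a₂) vk≡) (a+[b-a]≡b a₂ b₂))
  where
  +-*-zeroʳ : ∀ a u → a + u * 0ℤ ≡ a
  +-*-zeroʳ = solve-∀
  a+[b-a]≡b : ∀ a b → a + (b - a) ≡ b
  a+[b-a]≡b = solve-∀

line-through : ∀ {m n} .{{_ : NonZero m}} .{{_ : NonZero n}} (s t : Torus m n) →
               Σ[ L ∈ (Torus m n → Set) ] (IsLine m n L × L s × L t)
line-through {m} {n} s t with ℤ-line-through (liftℤ s) (liftℤ t)
... | ℓ , on-s , on-t =
  torusLine ℓ m n , torusLine-isLine ℓ , (liftℤ s , on-s , π-liftℤ s) , (liftℤ t , on-t , π-liftℤ t)

ρ-line : ∀ {m n p} .{{_ : NonZero m}} .{{_ : NonZero n}} .{{_ : NonZero p}} → p ∣ m → p ∣ n →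
         ∀ {L} → IsLine m n L →
         Σ[ L′ ∈ (Torus p p → Set) ] (IsLine p p L′ × (∀ {t} → L t → L′ (ρ m n p t)))
ρ-line {m} {n} {p} p∣m p∣n {L} (ℓ , L⇔) = torusLine ℓ p p , torusLine-isLine ℓ , image
  where
  image : ∀ {t} → L t → torusLine ℓ p p (ρ m n p t)
  image {t} Lt with Equivalence.to (L⇔ t) Lt
  ... | z , on-z , πz≡t = z , on-z , trans (sym (ρ-π p∣m p∣n z)) (cong (ρ m n p) πz≡t)

-- No-three-in-line sets

module _ {A B : Set} (f : A → B) where

  All-≢-map⁺ : ∀ {x ys} → (∀ {y} → y ∈ ys → f x ≡ f y → x ≡ y) → All (x ≢_) ys → All (f x ≢_) (map f ys)
  All-≢-map⁺ inj [] = []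
  All-≢-map⁺ inj (x≢y ∷ x≢ys) = (x≢y ∘ inj (here refl)) ∷ All-≢-map⁺ (inj ∘ there) x≢ys

  Unique-map⁺ : ∀ {xs} → (∀ {x y} → x ∈ xs → y ∈ xs → f x ≡ f y → x ≡ y) → Unique xs → Unique (map f xs)
  Unique-map⁺ inj [] = []
  Unique-map⁺ inj (x≢xs ∷ xs!) =
    All-≢-map⁺ (inj (here refl) ∘ there) x≢xs ∷ Unique-map⁺ (λ x∈ y∈ → inj (there x∈) (there y∈)) xs!

third-point : ∀ {A : Set} → DecidableEquality A → ∀ {a b c} → a ≢ b → b ≢ c → a ≢ c →
              ∀ x y → ∃[ z ] (z ∈ a ∷ b ∷ c ∷ [] × z ≢ x × z ≢ y)
third-point _≟_ {a} {b} {c} a≢b b≢c a≢c x y with a ≟ x | a ≟ y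
... | no a≢x | no a≢y = a , here refl , a≢x , a≢y
... | yes refl | _ with b ≟ y
...   | no b≢y = b , there (here refl) , ≢-sym a≢b , b≢y
...   | yes refl = c , there (there (here refl)) , ≢-sym a≢c , ≢-sym b≢c
third-point _≟_ {a} {b} {c} a≢b b≢c a≢c x y | no a≢x | yes refl with b ≟ x
...   | no b≢x = b , there (here refl) , b≢x , ≢-sym a≢b
...   | yes refl = c , there (there (here refl)) , ≢-sym b≢c , ≢-sym a≢c

_≟ᵀ_ : ∀ {m n} → DecidableEquality (Torus m n)
_≟ᵀ_ = ≡-dec F._≟_ F._≟_

module _ {m n : ℕ} .{{_ : NonZero m}} .{{_ : NonZero n}} where

  pair-noThreeInLine : ∀ {u v : Torus m n} → u ≢ v → NoThreeInLine m n (u ∷ v ∷ [])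
  pair-noThreeInLine u≢v = record
    { distinct = (u≢v ∷ []) ∷ [] ∷ []
    ; noThree  = λ x∈ y∈ z∈ x≢y y≢z x≢z _ → pigeonhole x∈ y∈ z∈ x≢y y≢z x≢z
    }
    where
    pigeonhole : ∀ {u v x y z : Torus m n} → x ∈ u ∷ v ∷ [] → y ∈ u ∷ v ∷ [] → z ∈ u ∷ v ∷ [] →
                 x ≢ y → y ≢ z → x ≢ z → ⊥
    pigeonhole (here refl)         (here refl)         _                   x≢y _   _   = x≢y refl
    pigeonhole (there (here refl)) (there (here refl)) _                   x≢y _   _   = x≢y refl
    pigeonhole _                   (here refl)         (here refl)         _   y≢z _   = y≢z refl
    pigeonhole _                   (there (here refl)) (there (here refl)) _   y≢z _   = y≢z refl
    pigeonhole (here refl)         _                   (here refl)         _   _   x≢z = x≢z refl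
    pigeonhole (there (here refl)) _                   (there (here refl)) _   _   x≢z = x≢z refl
    pigeonhole (there (there ()))  _                   _                   _   _   _
    pigeonhole _                   (there (there ()))  _                   _   _   _
    pigeonhole _                   _                   (there (there ()))  _   _   _

module _ {a b c d : ℕ} .{{_ : NonZero a}} .{{_ : NonZero b}} .{{_ : NonZero c}} .{{_ : NonZero d}} where

  noThreeInLine-map : (f : Torus a b → Torus c d) {S : List (Torus a b)} →
                      (∀ {x y} → x ∈ S → y ∈ S → f x ≡ f y → x ≡ y) →
                      (∀ {x y z} → Collinear c d (f x) (f y) (f z) → Collinear a b x y z) →
                      NoThreeInLine a b S → NoThreeInLine c d (map f S)
  noThreeInLine-map f {S} inj reflect N = record
    { distinct = Unique-map⁺ f inj distinct
    ; noThree  = noThree′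
    }
    where
    open NoThreeInLine N
    noThree′ : ∀ {x y z} → x ∈ map f S → y ∈ map f S → z ∈ map f S →
               x ≢ y → y ≢ z → x ≢ z → ¬ Collinear c d x y z
    noThree′ x∈ y∈ z∈ x≢y y≢z x≢z col with ∈-map⁻ f x∈ | ∈-map⁻ f y∈ | ∈-map⁻ f z∈
    ... | x₀ , x₀∈ , refl | y₀ , y₀∈ , refl | z₀ , z₀∈ , refl =
      noThree x₀∈ y₀∈ z₀∈ (x≢y ∘ cong f) (y≢z ∘ cong f) (x≢z ∘ cong f) (reflect col)

  τ-mono : ∀ {s t} → IsTau a b s → IsTau c d t →
           (∀ S → NoThreeInLine a b S → Σ[ S′ ∈ List (Torus c d) ] (NoThreeInLine c d S′ × length S ≤ length S′)) →
           s ≤ t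
  τ-mono τs τt transfer with IsTau.attained τs
  ... | S , N , refl with transfer S N
  ...   | S′ , N′ , S≤S′ = ℕP.≤-trans S≤S′ (IsTau.maximal τt S′ N′)

-- Comparing τ(T_{m×n}) with τ(T_{p×p})

module _ {m n p : ℕ} .{{_ : NonZero m}} .{{_ : NonZero n}} .{{_ : NonZero p}}
         (p∣m : p ∣ m) (p∣n : p ∣ n) where

  τ[p×p]≤τ[m×n] : (tmn tpp : ℕ) → IsTau m n tmn → IsTau p p tpp → tpp ≤ tmn
  τ[p×p]≤τ[m×n] _ _ τmn τpp = τ-mono τpp τmn λ S N →
    map ι S , noThreeInLine-map ι (λ _ _ → ι-injective) reflect N , ℕP.≤-reflexive (sym (length-map ι S))
    where
    p≤m = ∣⇒≤ p∣m
    p≤n = ∣⇒≤ p∣n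
    ι : Torus p p → Torus m n
    ι = embed p≤m p≤n
    ι-injective : ∀ {s t} → ι s ≡ ι t → s ≡ t
    ι-injective {s} {t} eq =
      trans (sym (ρ-embed p≤m p≤n s)) (trans (cong (ρ m n p) eq) (ρ-embed p≤m p≤n t))
    reflect : ∀ {x y z} → Collinear m n (ι x) (ι y) (ι z) → Collinear p p x y z
    reflect (L , isL , Lx , Ly , Lz) with ρ-line p∣m p∣n isL
    ... | L′ , isL′ , L⇒L′ = L′ , isL′ , pull Lx , pull Ly , pull Lz
      where
      pull : ∀ {t} → L (ι t) → L′ t
      pull {t} = subst L′ (ρ-embed p≤m p≤n t) ∘ L⇒L′

module _ {m n p : ℕ} .{{_ : NonZero m}} .{{_ : NonZero n}} .{{_ : NonZero p}} (1<p : 1 < p)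
         (lines-pull-back : (L : Torus p p → Set) → IsLine p p L → IsLine m n (λ t → L (ρ m n p t))) where

  collinear-pull-back : ∀ {x y z} → Collinear p p (ρ m n p x) (ρ m n p y) (ρ m n p z) → Collinear m n x y z
  collinear-pull-back (L , isL , Lx , Ly , Lz) = (λ t → L (ρ m n p t)) , lines-pull-back L isL , Lx , Ly , Lz

  ρ-identified⇒collinear : ∀ {x y} z → ρ m n p x ≡ ρ m n p y → Collinear m n x y z
  ρ-identified⇒collinear {x} z ρx≡ρy =
    let (L , isL , Lρx , Lρz) = line-through (ρ m n p x) (ρ m n p z)
    in collinear-pull-back (L , isL , Lρx , subst L ρx≡ρy Lρx , Lρz)

  ρ-injective-on : ∀ {a b c rest} → let S = a ∷ b ∷ c ∷ rest in
                   NoThreeInLine m n S → ∀ {x y} → x ∈ S → y ∈ S → ρ m n p x ≡ ρ m n p y → x ≡ y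
  ρ-injective-on N {x} {y} x∈ y∈ ρx≡ρy with x ≟ᵀ y | NoThreeInLine.distinct N
  ... | yes x≡y | _ = x≡y
  ... | no x≢y | (a≢b ∷ a≢c ∷ _) ∷ (b≢c ∷ _) ∷ _ =
    let (z , z∈abc , z≢x , z≢y) = third-point _≟ᵀ_ a≢b b≢c a≢c x y
    in ⊥-elim (NoThreeInLine.noThree N x∈ y∈ (∈-++⁺ˡ z∈abc) x≢y (≢-sym z≢y) (≢-sym z≢x)
                 (ρ-identified⇒collinear z ρx≡ρy))

  at-most-two-dominated : ∀ {k} → k ≤ 2 → Σ[ S′ ∈ List (Torus p p) ] (NoThreeInLine p p S′ × k ≤ length S′)
  at-most-two-dominated k≤2 = (o , o) ∷ (o , i) ∷ [] , pair-noThreeInLine (o≢i ∘ cong proj₂) , k≤2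
    where
    o i : Fin p
    o = fromℕ< (ℕP.<-trans z<s 1<p)
    i = fromℕ< 1<p
    o≢i : o ≢ i
    o≢i = ℕP.0≢1+n ∘ FP.fromℕ<-injective 0 1 _ _

  τ[m×n]≤τ[p×p] : (tmn tpp : ℕ) → IsTau m n tmn → IsTau p p tpp → tmn ≤ tpp
  τ[m×n]≤τ[p×p] _ _ τmn τpp = τ-mono τmn τpp transfer
    where
    transfer : ∀ S → NoThreeInLine m n S →
               Σ[ S′ ∈ List (Torus p p) ] (NoThreeInLine p p S′ × length S ≤ length S′)
    transfer []           _ = at-most-two-dominated z≤n
    transfer (_ ∷ [])     _ = at-most-two-dominated (s≤s z≤n)
    transfer (_ ∷ _ ∷ []) _ = at-most-two-dominated ℕP.≤-refl
    transfer S@(_ ∷ _ ∷ _ ∷ _) N =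
      map (ρ m n p) S , noThreeInLine-map (ρ m n p) (ρ-injective-on N) collinear-pull-back N ,
      ℕP.≤-reflexive (sym (length-map (ρ m n p) S))

lemma4p1 : (m n : ℕ) → 1 < m → 1 < n → 1 < gcd m n →
           {{_ : NonZero m}} → {{_ : NonZero n}} → {{_ : NonZero (gcd m n)}} →
           ((tmn tpp : ℕ) → IsTau m n tmn → IsTau (gcd m n) (gcd m n) tpp → tpp ≤ tmn)
           × (((ℓ : Torus (gcd m n) (gcd m n) → Set) → IsLine (gcd m n) (gcd m n) ℓ →
                IsLine m n (λ t → ℓ (ρ m n (gcd m n) t))) →
              (tmn tpp : ℕ) → IsTau m n tmn → IsTau (gcd m n) (gcd m n) tpp → tmn ≡ tpp)
lemma4p1 m n _ _ 1<p = lower , λ pull-back tmn tpp τmn τpp →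
  ℕP.≤-antisym (τ[m×n]≤τ[p×p] 1<p pull-back tmn tpp τmn τpp) (lower tmn tpp τmn τpp)
  where
  lower : (tmn tpp : ℕ) → IsTau m n tmn → IsTau (gcd m n) (gcd m n) tpp → tpp ≤ tmn
  lower = τ[p×p]≤τ[m×n] (gcd[m,n]∣m m n) (gcd[m,n]∣n m n)
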